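{- For every integer $k\ge 6$ and for infinitely many values of $n$, there is a set of $n$ segments in the plane whose intersection graph has maximum degree $k$, layered treewidth at least $\frac{1}{256}(k-5)$, and treewidth at least $\frac18\sqrt{(k-5)n}-1$.
   Context: A layering of a graph $G$ is a partition $(V_0,\dots,V_t)$ of $V(G)$ such that for each edge $vw$ with $v\in V_i$, $w\in V_j$, $|i-j|\le 1$. The layered width of a tree decomposition is the minimum $\ell$ such that for some layering, each bag contains at most $\ell$ vertices of each layer; the layered treewidth of $G$ is the minimum layered width over tree decompositions of $G$. -}

module Defs where

open import Data.Nat as ℕ using (ℕ; zero; suc; _≤_; _∸_)
open import Data.Fin using (Fin; toℕ; suc)
open import Data.Fin.Subset using (Subset; _∈_; _∩_; ∣_∣)
open import Data.Vec using (tabulate)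
open import Data.Bool using (Bool)
open import Data.Rational as ℚ using (ℚ; 0ℚ; 1ℚ)
open import Data.Product using (Σ; ∃; _×_; _,_)
open import Data.Sum using (_⊎_)
open import Data.List using (List; length)
open import Data.List.Relation.Unary.All using (All)
open import Data.List.Relation.Unary.Unique.Propositional using (Unique)
open import Relation.Binary.PropositionalEquality using (_≡_)
open import Relation.Nullary using (¬_)
open import Relation.Nullary.Decidable using (⌊_⌋)

Point : Set
Point = ℚ × ℚ

Segment : Set
Segment = Point × Point

interp : Point → Point → ℚ → Point
interp (a₁ , a₂) (b₁ , b₂) l =
  ((1ℚ ℚ.- l) ℚ.* a₁ ℚ.+ l ℚ.* b₁) , ((1ℚ ℚ.- l) ℚ.* a₂ ℚ.+ l ℚ.* b₂)

SegIntersect : Segment → Segment → Set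
SegIntersect (a , b) (c , d) =
  Σ ℚ λ l → Σ ℚ λ m →
    (0ℚ ℚ.≤ l) × (l ℚ.≤ 1ℚ) × (0ℚ ℚ.≤ m) × (m ℚ.≤ 1ℚ) ×
    (interp a b l ≡ interp c d m)

Graph : ℕ → Set₁
Graph n = Fin n → Fin n → Set

IntersectionGraph : ∀ {n} → (Fin n → Segment) → Graph n
IntersectionGraph s i j = ¬ (i ≡ j) × SegIntersect (s i) (s j)

NeighbourList : ∀ {n} → Graph n → Fin n → List (Fin n) → Set
NeighbourList G v xs = Unique xs × All (G v) xs

MaxDegree : ∀ {n} → Graph n → ℕ → Set
MaxDegree {n} G k =
  (∀ v xs → NeighbourList G v xs → length xs ≤ k) ×
  (Σ (Fin n) λ v → Σ (List (Fin n)) λ xs → NeighbourList G v xs × length xs ≡ k)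

-- Trees: a tree on node set Fin (suc m) is encoded by a parent function;
-- node (suc i) has parent (parent i), with toℕ (parent i) ≤ toℕ i.
-- Every finite tree has such an encoding (e.g. in BFS order).

record Tree : Set where
  field
    m      : ℕ
    parent : Fin m → Fin (suc m)
    parent≤ : ∀ i → toℕ (parent i) ≤ toℕ i

  Node : Set
  Node = Fin (suc m)

  Adj : Node → Node → Set
  Adj a b = Σ (Fin m) λ i →
    ((a ≡ suc i) × (b ≡ parent i)) ⊎ ((b ≡ suc i) × (a ≡ parent i))

  data PathIn (S : Node → Set) : Node → Node → Set where
    here : ∀ {a} → S a → PathIn S a a
    step : ∀ {a b c} → Adj a b → S a → PathIn S b c → PathIn S a c

record TreeDecomposition {n : ℕ} (G : Graph n) : Set where
  field
    tree : Tree
  open Tree tree public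
  field
    bag : Node → Subset n
    covers-vertices : ∀ v → Σ Node λ t → v ∈ bag t
    covers-edges : ∀ v w → G v w → Σ Node λ t → (v ∈ bag t) × (w ∈ bag t)
    connected : ∀ v a b → v ∈ bag a → v ∈ bag b →
                PathIn (λ t → v ∈ bag t) a b

record Layering {n : ℕ} (G : Graph n) : Set where
  field
    layer : Fin n → ℕ
    edge-ok : ∀ v w → G v w →
              (layer v ≡ layer w) ⊎ (suc (layer v) ≡ layer w) ⊎ (layer v ≡ suc (layer w))

layerSet : ∀ {n} {G : Graph n} → Layering G → ℕ → Subset n
layerSet L i = tabulate λ v → ⌊ Layering.layer L v ℕ.≟ i ⌋

-- Lower bounds on treewidth and layered treewidth.
-- treewidth G ≥ x  iff every tree decomposition has some bag of size ≥ x + 1.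

-- treewidth(G) ≥ (1/8)·√((k-5)·n) − 1, i.e. every tree decomposition has a
-- bag of size s with 8 s ≥ √((k-5) n), i.e. 64 s² ≥ (k-5) n.
TreewidthBound : ∀ {n} → Graph n → ℕ → Set
TreewidthBound {n} G k =
  (D : TreeDecomposition G) →
  Σ (TreeDecomposition.Node D) λ t →
    let s = ∣ TreeDecomposition.bag D t ∣ in
    (k ∸ 5) ℕ.* n ≤ 64 ℕ.* (s ℕ.* s)

-- layered treewidth(G) ≥ (k-5)/256: for every tree decomposition and every
-- layering some bag meets some layer in ℓ vertices with 256 ℓ ≥ k - 5.
LayeredTreewidthBound : ∀ {n} → Graph n → ℕ → Set
LayeredTreewidthBound G k =
  (D : TreeDecomposition G) → (L : Layering G) →
  Σ (TreeDecomposition.Node D) λ t → Σ ℕ λ i →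
    (k ∸ 5) ≤ 256 ℕ.* ∣ TreeDecomposition.bag D t ∩ layerSet L i ∣

-- Construction (w ≥ 1 with 4w + 2 ≤ k ≤ 4w + 5, P = N + 1): on each of P
-- horizontal lines lie w staggered paths of P segments of length w, the
-- same vertically, and a star of k + 1 segments with a common endpoint.
-- A grid segment meets at most 2w collinear and 2(w+1) crossing segments,
-- so the degree is at most k, attained in the star.  A horizontal path
-- joined with a vertical one is a connected "cross", and any two crosses
-- touch; by the Helly property of subtrees some bag meets every cross, so
-- it meets all P·w paths of one direction (treewidth).  The star is a
-- clique: it lies in one bag and in two consecutive layers (layered
-- treewidth).
module Submission where

open import Data.Nat as ℕ using (ℕ; zero; suc; z≤n; s≤s)
open import Data.Fin as Fin using (Fin; toℕ)
open import Data.Product using (Σ; _×_; _,_; proj₁; proj₂)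
open import Data.Sum using (_⊎_; inj₁; inj₂)
open import Relation.Binary.PropositionalEquality
open import Relation.Nullary using (¬_; Dec; yes; no)
open import Data.Empty using (⊥-elim)
open import Defs

module Interpolation where
  import Data.Nat.Properties as ℕP
  open import Data.Rational using (ℚ; 0ℚ; 1ℚ; _+_; _*_; _-_; -_; _≤_; _<_; 1/_; Positive; NonNegative; NonZero; positive; nonNegative)
  open import Data.Rational.Properties
  open import Data.Rational.Solver using (module +-*-Solver)
  open +-*-Solver

  ι : ℕ → ℚ
  ι zero = 0ℚ
  ι (suc n) = 1ℚ + ι n

  ι-<-suc : ∀ n → ι n < ι (suc n)
  ι-<-suc n = subst (_< 1ℚ + ι n) (+-identityˡ (ι n)) (+-monoˡ-< (ι n) (positive⁻¹ 1ℚ))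

  ι-mono-≤ : ∀ {m n} → m ℕ.≤ n → ι m ≤ ι n
  ι-mono-≤ {zero} {zero} _ = ≤-refl
  ι-mono-≤ {zero} {suc n} _ = <⇒≤ (≤-<-trans (ι-mono-≤ {zero} {n} ℕ.z≤n) (ι-<-suc n))
  ι-mono-≤ {suc m} {suc n} (ℕ.s≤s m≤n) = +-monoʳ-≤ 1ℚ (ι-mono-≤ m≤n)

  ι-mono-< : ∀ {m n} → m ℕ.< n → ι m < ι n
  ι-mono-< {m} {suc n} (ℕ.s≤s m≤n) = ≤-<-trans (ι-mono-≤ m≤n) (ι-<-suc n)

  ι-cancel-≤ : ∀ {m n} → ι m ≤ ι n → m ℕ.≤ n
  ι-cancel-≤ {m} {n} ιm≤ιn with m ℕ.≤? n
  ... | yes m≤n = m≤n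
  ... | no m≰n = ⊥-elim (<-irrefl refl (<-≤-trans (ι-mono-< (ℕP.≰⇒> m≰n)) ιm≤ιn))

  ι-injective : ∀ {m n} → ι m ≡ ι n → m ≡ n
  ι-injective e = ℕP.≤-antisym (ι-cancel-≤ (≤-reflexive e)) (ι-cancel-≤ (≤-reflexive (sym e)))

  ι-nonNeg : ∀ n → 0ℚ ≤ ι n
  ι-nonNeg n = ι-mono-≤ (ℕ.z≤n {n})

  lerp : ℚ → ℚ → ℚ → ℚ
  lerp x y l = (1ℚ - l) * x + l * y

  lerp-const : ∀ x l → lerp x x l ≡ x
  lerp-const = solve 2 (λ x l → (con 1ℚ :- l) :* x :+ l :* x := x) refl

  lerp-0 : ∀ x y → lerp x y 0ℚ ≡ x
  lerp-0 = solve 2 (λ x y → (con 1ℚ :- con 0ℚ) :* x :+ con 0ℚ :* y := x) refl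

  lerp-1 : ∀ x y → lerp x y 1ℚ ≡ y
  lerp-1 = solve 2 (λ x y → (con 1ℚ :- con 1ℚ) :* x :+ con 1ℚ :* y := y) refl

  lerp-offset : ∀ x y l → lerp x y l ≡ x + l * (y - x)
  lerp-offset = solve 3 (λ x y l → (con 1ℚ :- l) :* x :+ l :* y := x :+ l :* (y :- x)) refl

  0≤1 : 0ℚ ≤ 1ℚ
  0≤1 = nonNegative⁻¹ 1ℚ

  difference-nonNeg : ∀ {x y} → x ≤ y → 0ℚ ≤ y - x
  difference-nonNeg {x} {y} x≤y = subst (_≤ y - x) (+-inverseʳ x) (+-monoˡ-≤ (- x) x≤y)

  difference-pos : ∀ {x y} → x < y → 0ℚ < y - x
  difference-pos {x} {y} x<y = subst (_< y - x) (+-inverseʳ x) (+-monoˡ-< (- x) x<y)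

  lerp-between : ∀ {x y l} → x ≤ y → 0ℚ ≤ l → l ≤ 1ℚ → x ≤ lerp x y l × lerp x y l ≤ y
  lerp-between {x} {y} {l} x≤y 0≤l l≤1 =
    subst (x ≤_) (sym (lerp-offset x y l)) (subst (_≤ x + l * d) (+-identityʳ x) (+-monoʳ-≤ x 0≤ld)) ,
    subst (_≤ y) (sym (lerp-offset x y l)) (subst (x + l * d ≤_) x+d≡y (+-monoʳ-≤ x ld≤d))
    where
    d = y - x
    instance d-nonNeg : NonNegative d
    d-nonNeg = nonNegative (difference-nonNeg x≤y)
    0≤ld : 0ℚ ≤ l * d
    0≤ld = subst (_≤ l * d) (*-zeroˡ d) (*-monoʳ-≤-nonNeg d 0≤l)
    ld≤d : l * d ≤ d
    ld≤d = subst (l * d ≤_) (*-identityˡ d) (*-monoʳ-≤-nonNeg d l≤1)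
    x+d≡y : x + d ≡ y
    x+d≡y = solve 2 (λ x y → x :+ (y :- x) := y) refl x y

  -- Conversely every value between x < y is attained, at λ = (z-x)/(y-x).
  lerp-onto : ∀ {x y z} → x < y → x ≤ z → z ≤ y →
    Σ ℚ λ l → 0ℚ ≤ l × l ≤ 1ℚ × lerp x y l ≡ z
  lerp-onto {x} {y} {z} x<y x≤z z≤y = l , 0≤l , l≤1 , hits
    where
    d = y - x
    instance d-pos : Positive d
    d-pos = positive (difference-pos x<y)
    instance d-nonZero : NonZero d
    d-nonZero = pos⇒nonZero d
    instance d⁻¹-nonNeg : NonNegative (1/ d)
    d⁻¹-nonNeg = pos⇒nonNeg (1/ d) {{1/pos⇒pos d}}
    l = (z - x) * 1/ d
    0≤l : 0ℚ ≤ l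
    0≤l = subst (_≤ l) (*-zeroˡ (1/ d)) (*-monoʳ-≤-nonNeg (1/ d) (difference-nonNeg x≤z))
    l≤1 : l ≤ 1ℚ
    l≤1 = subst (l ≤_) (*-inverseʳ d) (*-monoʳ-≤-nonNeg (1/ d) (+-monoˡ-≤ (- x) z≤y))
    hits : lerp x y l ≡ z
    hits = begin
      lerp x y l                  ≡⟨ lerp-offset x y l ⟩
      x + (z - x) * 1/ d * d      ≡⟨ cong (x +_) (*-assoc (z - x) (1/ d) d) ⟩
      x + (z - x) * (1/ d * d)    ≡⟨ cong (λ u → x + (z - x) * u) (*-inverseˡ d) ⟩
      x + (z - x) * 1ℚ            ≡⟨ solve 2 (λ x z → x :+ (z :- x) :* con 1ℚ := z) refl x z ⟩
      z                           ∎
      where open ≡-Reasoning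

module AxisSegments where
  open Interpolation
  open import Data.Rational using (ℚ; 0ℚ; 1ℚ; _≤_; _<_)
  open import Data.Rational.Properties using (≤-refl; ≤-trans; ≤-reflexive)

  hseg : ℚ → ℚ → ℚ → Segment
  hseg x₁ x₂ y = (x₁ , y) , (x₂ , y)

  transpose : Point → Point
  transpose (x , y) = y , x

  transposeS : Segment → Segment
  transposeS (a , b) = transpose a , transpose b

  vseg : ℚ → ℚ → ℚ → Segment
  vseg x y₁ y₂ = transposeS (hseg y₁ y₂ x)

  meet-transpose : ∀ {s t} → SegIntersect s t → SegIntersect (transposeS s) (transposeS t)
  meet-transpose (l , m , bounds₁ , bounds₂ , bounds₃ , bounds₄ , e) =
    l , m , bounds₁ , bounds₂ , bounds₃ , bounds₄ , cong transpose e

  meet-sym : ∀ {s t} → SegIntersect s t → SegIntersect t s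
  meet-sym (l , m , 0≤l , l≤1 , 0≤m , m≤1 , e) = m , l , 0≤m , m≤1 , 0≤l , l≤1 , sym e

  meet-common-start : ∀ a b c → SegIntersect (a , b) (a , c)
  meet-common-start (a₁ , a₂) (b₁ , b₂) (c₁ , c₂) = 0ℚ , 0ℚ , ≤-refl , 0≤1 , ≤-refl , 0≤1 ,
    cong₂ _,_ (trans (lerp-0 a₁ b₁) (sym (lerp-0 a₁ c₁))) (trans (lerp-0 a₂ b₂) (sym (lerp-0 a₂ c₂)))

  meet-consecutive : ∀ a b c → SegIntersect (a , b) (b , c)
  meet-consecutive (a₁ , a₂) (b₁ , b₂) (c₁ , c₂) = 1ℚ , 0ℚ , 0≤1 , ≤-refl , ≤-refl , 0≤1 ,
    cong₂ _,_ (trans (lerp-1 a₁ b₁) (sym (lerp-0 b₁ c₁))) (trans (lerp-1 a₂ b₂) (sym (lerp-0 b₂ c₂)))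

  horizontal-meet : ∀ {x₁ x₂ y x₁' x₂' y'} → x₁ ≤ x₂ → x₁' ≤ x₂' →
    SegIntersect (hseg x₁ x₂ y) (hseg x₁' x₂' y') →
    y ≡ y' × x₁ ≤ x₂' × x₁' ≤ x₂
  horizontal-meet {x₁} {x₂} {y} {x₁'} {x₂'} {y'} x₁≤x₂ x₁'≤x₂' (l , m , 0≤l , l≤1 , 0≤m , m≤1 , e) =
    trans (sym (lerp-const y l)) (trans (cong proj₂ e) (lerp-const y' m)) ,
    ≤-trans (proj₁ onFirst) (≤-trans (≤-reflexive (cong proj₁ e)) (proj₂ onSecond)) ,
    ≤-trans (proj₁ onSecond) (≤-trans (≤-reflexive (sym (cong proj₁ e))) (proj₂ onFirst))
    where
    onFirst = lerp-between {l = l} x₁≤x₂ 0≤l l≤1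
    onSecond = lerp-between {l = m} x₁'≤x₂' 0≤m m≤1

  horizontal-vertical-meet : ∀ {x₁ x₂ y x y₁ y₂} → x₁ ≤ x₂ → y₁ ≤ y₂ →
    SegIntersect (hseg x₁ x₂ y) (vseg x y₁ y₂) →
    (x₁ ≤ x × x ≤ x₂) × (y₁ ≤ y × y ≤ y₂)
  horizontal-vertical-meet {x₁} {x₂} {y} {x} {y₁} {y₂} x₁≤x₂ y₁≤y₂ (l , m , 0≤l , l≤1 , 0≤m , m≤1 , e) =
    subst (λ u → x₁ ≤ u × u ≤ x₂) atX (lerp-between x₁≤x₂ 0≤l l≤1) ,
    subst (λ u → y₁ ≤ u × u ≤ y₂) atY (lerp-between y₁≤y₂ 0≤m m≤1)
    where
    atX : lerp x₁ x₂ l ≡ x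
    atX = trans (cong proj₁ e) (lerp-const x m)
    atY : lerp y₁ y₂ m ≡ y
    atY = trans (sym (cong proj₂ e)) (lerp-const y l)

  horizontal-vertical-cross : ∀ {x₁ x₂ y x y₁ y₂} → x₁ < x₂ → y₁ < y₂ →
    x₁ ≤ x → x ≤ x₂ → y₁ ≤ y → y ≤ y₂ →
    SegIntersect (hseg x₁ x₂ y) (vseg x y₁ y₂)
  horizontal-vertical-cross {x₁} {x₂} {y} {x} {y₁} {y₂} x₁<x₂ y₁<y₂ x₁≤x x≤x₂ y₁≤y y≤y₂ =
    meet (lerp-onto x₁<x₂ x₁≤x x≤x₂) (lerp-onto y₁<y₂ y₁≤y y≤y₂)
    where
    meet : (Σ ℚ λ l → 0ℚ ≤ l × l ≤ 1ℚ × lerp x₁ x₂ l ≡ x) → (Σ ℚ λ m → 0ℚ ≤ m × m ≤ 1ℚ × lerp y₁ y₂ m ≡ y) →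
      SegIntersect (hseg x₁ x₂ y) (vseg x y₁ y₂)
    meet (l , 0≤l , l≤1 , atX) (m , 0≤m , m≤1 , atY) =
      l , m , 0≤l , l≤1 , 0≤m , m≤1 ,
      cong₂ _,_ (trans atX (sym (lerp-const x m))) (trans (lerp-const y l) (sym atY))

module Counting where
  open import Data.Nat using (_+_; _≤_; _<_)
  import Data.Nat.Properties as ℕP
  import Data.Fin.Properties as FinP
  open import Data.Bool using (true; false)
  open import Data.Vec using ([]; _∷_)
  open import Data.Fin.Subset using (Subset; _∈_; ∣_∣; ⊤; _-_; _∪_)
  open import Data.Fin.Subset.Properties
  open import Data.List using (List; []; _∷_; length; map; allFin)
  open import Data.List.Properties using (length-map; length-tabulate)
  open import Data.List.Relation.Unary.All using (All; []; _∷_)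
  import Data.List.Relation.Unary.All as All
  import Data.List.Relation.Unary.All.Properties as All
  open import Data.List.Relation.Unary.AllPairs using (AllPairs)
  import Data.List.Relation.Unary.AllPairs.Properties as AllPairs
  open import Data.List.Relation.Unary.AllPairs using ([]; _∷_)
  open import Data.List.Relation.Unary.Unique.Propositional using (Unique)
  import Data.List.Relation.Unary.Unique.Propositional.Properties as Unique

  unique-⊆-card : ∀ {n} {p : Subset n} xs → Unique xs → All (_∈ p) xs → length xs ≤ ∣ p ∣
  unique-⊆-card [] _ _ = z≤n
  unique-⊆-card {p = p} (x ∷ xs) (x∉xs ∷ unique) (x∈p ∷ xs⊆p) =
    ℕP.≤-trans (s≤s (unique-⊆-card {p = p - x} xs unique (All.zipWith removed (x∉xs , xs⊆p))))
               (x∈p⇒∣p-x∣<∣p∣ x∈p)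
    where
    removed : ∀ {y} → ¬ x ≡ y × y ∈ p → y ∈ p - x
    removed (x≢y , y∈p) = x∈p∧x∉q⇒x∈p─q y∈p (λ y∈x → x≢y (sym (x∈⁅y⁆⇒x≡y _ y∈x)))

  injective-image-card : ∀ {m n} {p : Subset n} (f : Fin m → Fin n) →
    (∀ {i j} → f i ≡ f j → i ≡ j) → (∀ i → f i ∈ p) → m ≤ ∣ p ∣
  injective-image-card {m} f f-injective f∈p =
    subst (_≤ _) (trans (length-map f (allFin m)) (length-tabulate {n = m} (λ i → i)))
      (unique-⊆-card (map f (allFin m)) (Unique.map⁺ f-injective (Unique.allFin⁺ m))
        (All.map⁺ (All.tabulate⁺ f∈p)))

  hitting-card : ∀ {I : Set} {m n} {p : Subset n} (index : Fin m → I) → (∀ {i j} → index i ≡ index j → i ≡ j) →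
    (X : I → Fin n → Set) → (∀ {i j v} → X i v → X j v → i ≡ j) →
    (∀ i → Σ (Fin n) λ v → X i v × v ∈ p) → m ≤ ∣ p ∣
  hitting-card index index-injective X disjoint hit =
    injective-image-card (λ r → proj₁ (hit (index r)))
      (λ {r} {r'} e → index-injective (disjoint (proj₁ (proj₂ (hit (index r))))
                                                 (subst (X (index r')) (sym e) (proj₁ (proj₂ (hit (index r')))))))
      (λ r → proj₂ (proj₂ (hit (index r))))

  ∣p∪q∣≤∣p∣+∣q∣ : ∀ {n} (p q : Subset n) → ∣ p ∪ q ∣ ≤ ∣ p ∣ + ∣ q ∣
  ∣p∪q∣≤∣p∣+∣q∣ [] [] = z≤n
  ∣p∪q∣≤∣p∣+∣q∣ (false ∷ p) (false ∷ q) = ∣p∪q∣≤∣p∣+∣q∣ p q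
  ∣p∪q∣≤∣p∣+∣q∣ (false ∷ p) (true ∷ q) =
    ℕP.≤-trans (s≤s (∣p∪q∣≤∣p∣+∣q∣ p q)) (ℕP.≤-reflexive (sym (ℕP.+-suc ∣ p ∣ ∣ q ∣)))
  ∣p∪q∣≤∣p∣+∣q∣ (true ∷ p) (false ∷ q) = s≤s (∣p∪q∣≤∣p∣+∣q∣ p q)
  ∣p∪q∣≤∣p∣+∣q∣ (true ∷ p) (true ∷ q) = s≤s (ℕP.≤-trans (∣p∪q∣≤∣p∣+∣q∣ p q) (ℕP.+-monoʳ-≤ ∣ p ∣ (ℕP.n≤1+n ∣ q ∣)))

  larger-half : ∀ {x a b} → x ≤ a + b → x ≤ a + a ⊎ x ≤ b + b
  larger-half {x} {a} {b} x≤a+b with a ℕ.≤? b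
  ... | yes a≤b = inj₂ (ℕP.≤-trans x≤a+b (ℕP.+-monoˡ-≤ b a≤b))
  ... | no a≰b = inj₁ (ℕP.≤-trans x≤a+b (ℕP.+-monoʳ-≤ a (ℕP.<⇒≤ (ℕP.≰⇒> a≰b))))

  unique-below : ∀ {k} ns → Unique ns → All (_< k) ns → length ns ≤ k
  unique-below {k} ns unique ns<k =
    subst₂ _≤_ (length-asFin ns ns<k) (∣⊤∣≡n k)
      (unique-⊆-card (asFin ns ns<k) (asFin-unique ns ns<k unique) (All.universal (λ _ → ∈⊤) _))
    where
    asFin : ∀ ms → All (_< k) ms → List (Fin k)
    asFin [] [] = []
    asFin (m ∷ ms) (m<k ∷ ms<k) = Fin.fromℕ< m<k ∷ asFin ms ms<k
    length-asFin : ∀ ms ms<k → length (asFin ms ms<k) ≡ length ms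
    length-asFin [] [] = refl
    length-asFin (m ∷ ms) (_ ∷ ms<k) = cong suc (length-asFin ms ms<k)
    asFin-unique : ∀ ms ms<k → Unique ms → Unique (asFin ms ms<k)
    asFin-unique [] [] [] = []
    asFin-unique (m ∷ ms) (m<k ∷ ms<k) (m∉ms ∷ unique) = fresh ms ms<k m∉ms ∷ asFin-unique ms ms<k unique
      where
      fresh : ∀ ls ls<k → All (λ l → ¬ m ≡ l) ls → All (λ j → ¬ Fin.fromℕ< m<k ≡ j) (asFin ls ls<k)
      fresh [] [] [] = []
      fresh (l ∷ ls) (l<k ∷ ls<k) (m≢l ∷ m∉ls) =
        (λ e → m≢l (trans (sym (FinP.toℕ-fromℕ< m<k)) (trans (cong toℕ e) (FinP.toℕ-fromℕ< l<k))))
        ∷ fresh ls ls<k m∉ls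

  coded-list-bound : ∀ {A : Set} {Q : A → Set} {k} (code : A → ℕ) →
    (∀ {x} → Q x → code x < k) →
    (∀ {x y} → Q x → Q y → code x ≡ code y → x ≡ y) →
    ∀ xs → Unique xs → All Q xs → length xs ≤ k
  coded-list-bound {Q = Q} code bounded injective xs unique xs∈Q =
    subst (_≤ _) (length-map code xs)
      (unique-below (map code xs) (AllPairs.map⁺ (distinct-codes xs unique xs∈Q)) (All.map⁺ (All.map bounded xs∈Q)))
    where
    distinct-codes : ∀ ys → Unique ys → All Q ys → AllPairs (λ y z → ¬ code y ≡ code z) ys
    distinct-codes [] [] [] = []
    distinct-codes (y ∷ ys) (y∉ys ∷ unique) (qy ∷ ys∈Q) =
      All.zipWith (λ (y≢z , qz) e → y≢z (injective qy qz e)) (y∉ys , ys∈Q) ∷ distinct-codes ys unique ys∈Q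

module FiniteSearch where
  open import Data.Nat using (_≤_)
  import Data.Nat.Properties as ℕP

  HasArgMax : Set → Set
  HasArgMax I = (f : I → ℕ) → Σ I λ i → ∀ j → f j ≤ f i

  argmax-Fin : ∀ m → HasArgMax (Fin (suc m))
  argmax-Fin zero f = Fin.zero , λ { Fin.zero → ℕP.≤-refl }
  argmax-Fin (suc m) f with argmax-Fin m (λ j → f (Fin.suc j))
  ... | i , f≤fi with f Fin.zero ℕ.≤? f (Fin.suc i)
  ... | yes f0≤fi = Fin.suc i , λ { Fin.zero → f0≤fi ; (Fin.suc j) → f≤fi j }
  ... | no f0≰fi = Fin.zero , λ { Fin.zero → ℕP.≤-refl
                                ; (Fin.suc j) → ℕP.≤-trans (f≤fi j) (ℕP.<⇒≤ (ℕP.≰⇒> f0≰fi)) }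

  argmax-× : ∀ {A B} → HasArgMax A → HasArgMax B → HasArgMax (A × B)
  argmax-× maxA maxB f with maxA (λ a → f (a , proj₁ (maxB (λ b → f (a , b)))))
  ... | a , best-a = (a , proj₁ (maxB (λ b → f (a , b)))) ,
        λ (a' , b') → ℕP.≤-trans (proj₂ (maxB (λ b → f (a' , b))) b') (best-a a')

  argmin-Fin : ∀ m (f : Fin (suc m) → ℕ) → Σ (Fin (suc m)) λ i → ∀ j → f i ≤ f j
  argmin-Fin zero f = Fin.zero , λ { Fin.zero → ℕP.≤-refl }
  argmin-Fin (suc m) f with argmin-Fin m (λ j → f (Fin.suc j))
  ... | i , fi≤f with f (Fin.suc i) ℕ.≤? f Fin.zero
  ... | yes fi≤f0 = Fin.suc i , λ { Fin.zero → fi≤f0 ; (Fin.suc j) → fi≤f j }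
  ... | no fi≰f0 = Fin.zero , λ { Fin.zero → ℕP.≤-refl
                                ; (Fin.suc j) → ℕP.≤-trans (ℕP.<⇒≤ (ℕP.≰⇒> fi≰f0)) (fi≤f j) }

  least : ∀ {n} (P : Fin n → Set) → (∀ i → Dec (P i)) → Σ (Fin n) P →
    Σ (Fin n) λ r → P r × (∀ t → P t → toℕ r ≤ toℕ t)
  least {suc n} P P? (i , pi) with P? Fin.zero
  ... | yes p0 = Fin.zero , p0 , λ _ _ → z≤n
  ... | no ¬p0 with i
  ...   | Fin.zero = ⊥-elim (¬p0 pi)
  ...   | Fin.suc i' with least (λ j → P (Fin.suc j)) (λ j → P? (Fin.suc j)) (i' , pi)
  ...     | r , pr , r-least = Fin.suc r , pr ,
            λ { Fin.zero p0 → ⊥-elim (¬p0 p0) ; (Fin.suc t) pt → s≤s (r-least t pt) }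

-- Proof: each subtree has a top node (least index); every node of the
-- subtree lies below it, since the tree path from a node to the top
-- can only enter the part below the top through the top's parent.
-- Take the subtree whose top r is lowest; any other subtree meets it
-- below r, contains its own top, which is not below r, so it contains r.
module SubtreeHelly (T : Tree) where
  open import Data.Nat using (_≤_; _<_)
  import Data.Nat.Properties as ℕP
  import Data.Fin.Properties as FinP
  open Tree T
  open FiniteSearch

  path-start : ∀ {S a c} → PathIn S a c → S a
  path-start (here s) = s
  path-start (step _ s _) = s

  path-map : ∀ {S S' : Node → Set} → (∀ {t} → S t → S' t) → ∀ {a c} → PathIn S a c → PathIn S' a c
  path-map f (here s) = here (f s)
  path-map f (step adj s p) = step adj (f s) (path-map f p)

  _++ₚ_ : ∀ {S a b c} → PathIn S a b → PathIn S b c → PathIn S a c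
  here _ ++ₚ q = q
  step adj s p ++ₚ q = step adj s (p ++ₚ q)

  data Below (r : Node) : Node → Set where
    root : Below r r
    child : ∀ i → Below r (parent i) → Below r (Fin.suc i)

  below-index : ∀ {r x} → Below r x → toℕ r ≤ toℕ x
  below-index root = ℕP.≤-refl
  below-index (child i b) = ℕP.≤-trans (below-index b) (ℕP.≤-trans (parent≤ i) (ℕP.n≤1+n _))

  below-parent : ∀ {r i} → Below r (Fin.suc i) → ¬ r ≡ Fin.suc i → Below r (parent i)
  below-parent root r≢r = ⊥-elim (r≢r refl)
  below-parent (child i b) _ = b

  below? : ∀ r x → Dec (Below r x)
  below? r x = search (suc (toℕ x)) x ℕP.≤-refl
    where
    search : ∀ fuel y → toℕ y < fuel → Dec (Below r y)
    search (suc fuel) y y<fuel with r FinP.≟ y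
    ... | yes refl = yes root
    search (suc fuel) Fin.zero _ | no r≢0 = no λ { root → r≢0 refl }
    search (suc fuel) (Fin.suc i) (s≤s i<fuel) | no r≢y
      with search fuel (parent i) (ℕP.≤-<-trans (parent≤ i) i<fuel)
    ... | yes b = yes (child i b)
    ... | no ¬b = no λ b → ¬b (below-parent b r≢y)

  entering-edge : ∀ {r a b} → Adj a b → ¬ Below r a → Below r b → b ≡ r × toℕ a < toℕ r
  entering-edge (i , inj₁ (refl , refl)) ¬ba bb = ⊥-elim (¬ba (child i bb))
  entering-edge {r} (i , inj₂ (refl , refl)) ¬ba bb with r FinP.≟ Fin.suc i
  ... | yes refl = refl , s≤s (parent≤ i)
  ... | no r≢b = ⊥-elim (¬ba (below-parent bb r≢b))

  path-enters : ∀ {S r a c} → PathIn S a c → ¬ Below r a → Below r c →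
    S r × Σ Node λ a' → S a' × toℕ a' < toℕ r
  path-enters (here s) ¬ba bc = ⊥-elim (¬ba bc)
  path-enters {r = r} (step {a} {b} adj s p) ¬ba bc with below? r b
  ... | no ¬bb = path-enters p ¬bb bc
  ... | yes bb with entering-edge adj ¬ba bb
  ...   | refl , a<r = path-start p , a , s , a<r

  helly : ∀ {I : Set} → HasArgMax I → (S : I → Node → Set) → (∀ i t → Dec (S i t)) →
    (∀ i → Σ Node (S i)) →
    (∀ i {a b} → S i a → S i b → PathIn (S i) a b) →
    (∀ i j → Σ Node λ t → S i t × S j t) →
    Σ Node λ t → ∀ i → S i t
  helly {I} argmax S S? nonempty connected meet = r , r∈S
    where
    top : ∀ i → Σ Node λ r → S i r × (∀ t → S i t → toℕ r ≤ toℕ t)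
    top i = least (S i) (S? i) (nonempty i)

    below-top : ∀ i {t} → S i t → Below (proj₁ (top i)) t
    below-top i {t} t∈S with below? (proj₁ (top i)) t
    ... | yes b = b
    ... | no ¬b with path-enters (connected i t∈S (proj₁ (proj₂ (top i)))) ¬b root
    ...   | _ , a , a∈S , a<top = ⊥-elim (ℕP.<-irrefl refl (ℕP.<-≤-trans a<top (proj₂ (proj₂ (top i)) a a∈S)))

    lowest = argmax (λ i → toℕ (proj₁ (top i)))
    r = proj₁ (top (proj₁ lowest))

    r∈S : ∀ j → S j r
    r∈S j with meet (proj₁ lowest) j
    ... | x , x∈Si , x∈Sj with proj₁ (top j) FinP.≟ r
    ...   | yes topj≡r = subst (S j) topj≡r (proj₁ (proj₂ (top j)))
    ...   | no topj≢r = proj₁ (path-enters (connected j (proj₁ (proj₂ (top j))) x∈Sj) topj-outside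
                                           (below-top (proj₁ lowest) x∈Si))
      where
      topj-outside : ¬ Below r (proj₁ (top j))
      topj-outside b = topj≢r (FinP.toℕ-injective (ℕP.≤-antisym (proj₂ lowest j) (below-index b)))

module Decompositions {n : ℕ} (G : Graph n) where
  open import Data.Nat using (_+_; _≤_)
  import Data.Nat.Properties as ℕP
  import Data.Fin.Properties as FinP
  open import Data.Fin.Subset using (_∈_; _∩_; _∪_; ∣_∣)
  open import Data.Fin.Subset.Properties using (_∈?_; x∈p∩q⁺; x∈p∪q⁺)
  open import Relation.Nullary.Decidable using (_×-dec_; isYes≗does; dec-true)
  open import Data.Vec.Properties using (lookup⇒[]=; lookup∘tabulate)
  open FiniteSearch
  open Counting

  data Walk (X : Fin n → Set) : Fin n → Fin n → Set where
    stay : ∀ {u} → X u → Walk X u u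
    move : ∀ {u v z} → G u v → X u → Walk X v z → Walk X u z

  Connected : (Fin n → Set) → Set
  Connected X = ∀ {u v} → X u → X v → Walk X u v

  infixr 5 _++ʷ_
  _++ʷ_ : ∀ {X u v z} → Walk X u v → Walk X v z → Walk X u z
  stay _ ++ʷ later = later
  move uv xu walk ++ʷ later = move uv xu (walk ++ʷ later)

  walk-reverse : (∀ {u v} → G u v → G v u) → ∀ {X u v} → Walk X u v → Walk X v u
  walk-reverse symmetric (stay xu) = stay xu
  walk-reverse symmetric (move uv xu walk) =
    walk-reverse symmetric walk ++ʷ move (symmetric uv) (walk-start walk) (stay xu)
    where
    walk-start : ∀ {X a b} → Walk X a b → X a
    walk-start (stay xa) = xa
    walk-start (move _ xa _) = xa

  connected-via-hub : (∀ {u v} → G u v → G v u) → ∀ {X h} → (∀ {u} → X u → Walk X u h) → Connected X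
  connected-via-hub symmetric to-hub xu xv = to-hub xu ++ʷ walk-reverse symmetric (to-hub xv)

  Touch : (Fin n → Set) → (Fin n → Set) → Set
  Touch X Y = Σ (Fin n) λ u → Σ (Fin n) λ v → X u × Y v × (u ≡ v ⊎ G u v)

  Clique : ∀ {m} → (Fin m → Fin n) → Set
  Clique f = ∀ i j → ¬ i ≡ j → G (f i) (f j)

  module _ (D : TreeDecomposition G) where
    open TreeDecomposition D
    open SubtreeHelly tree

    Meets : (Fin n → Set) → Node → Set
    Meets X t = Σ (Fin n) λ v → X v × v ∈ bag t

    -- A walk inside X becomes a tree path through bags meeting X: consecutive
    -- vertices share a bag, and the bags containing one vertex are connected.
    walk-to-path : ∀ {X u v a b} → Walk X u v → u ∈ bag a → v ∈ bag b → PathIn (Meets X) a b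
    walk-to-path (stay xu) ua ub = path-map (λ h → _ , xu , h) (connected _ _ _ ua ub)
    walk-to-path {u = u} (move uv xu walk) ua vb with covers-edges u _ uv
    ... | t , ut , vt = path-map (λ h → u , xu , h) (connected u _ t ua ut) ++ₚ walk-to-path walk vt vb

    -- A bramble (connected, pairwise touching sets) indexed by a finite type
    -- has a bag meeting all its members: the sets of nodes meeting each
    -- member are pairwise intersecting subtrees.
    bramble-bag : ∀ {I : Set} → HasArgMax I → (X : I → Fin n → Set) → (∀ i v → Dec (X i v)) →
      (∀ i → Σ (Fin n) (X i)) → (∀ i → Connected (X i)) → (∀ i j → Touch (X i) (X j)) →
      Σ Node λ t → ∀ i → Meets (X i) t
    bramble-bag argmax X X? nonempty X-connected touch =
      helly argmax (λ i → Meets (X i)) meets? meets-nonempty meets-connected meets-pairwise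
      where
      meets? : ∀ i t → Dec (Meets (X i) t)
      meets? i t = FinP.any? (λ v → X? i v ×-dec (v ∈? bag t))
      meets-nonempty : ∀ i → Σ Node (Meets (X i))
      meets-nonempty i with nonempty i
      ... | v , xv with covers-vertices v
      ...   | t , vt = t , v , xv , vt
      meets-connected : ∀ i {a b} → Meets (X i) a → Meets (X i) b → PathIn (Meets (X i)) a b
      meets-connected i (u , xu , ua) (v , xv , vb) = walk-to-path (X-connected i xu xv) ua vb
      meets-pairwise : ∀ i j → Σ Node λ t → Meets (X i) t × Meets (X j) t
      meets-pairwise i j with touch i j
      ... | u , .u , xu , yu , inj₁ refl with covers-vertices u
      ...   | t , ut = t , (u , xu , ut) , (u , yu , ut)
      meets-pairwise i j | u , v , xu , yv , inj₂ uv with covers-edges u v uv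
      ...   | t , ut , vt = t , (u , xu , ut) , (v , yv , vt)

    -- Every clique lies in a single bag (its vertices form a bramble).
    clique-bag : ∀ {m} (f : Fin (suc m) → Fin n) → Clique f → Σ Node λ t → ∀ i → f i ∈ bag t
    clique-bag {m} f clique = proj₁ common , λ i → member (proj₂ common i)
      where
      touch : ∀ i j → Touch (_≡ f i) (_≡ f j)
      touch i j with i FinP.≟ j
      ... | yes refl = f i , f i , refl , refl , inj₁ refl
      ... | no i≢j = f i , f j , refl , refl , inj₂ (clique i j i≢j)
      common : Σ Node λ t → ∀ i → Meets (_≡ f i) t
      common = bramble-bag (argmax-Fin m) (λ i v → v ≡ f i) (λ i v → v FinP.≟ f i)
                 (λ i → f i , refl) (λ i → λ { refl refl → stay refl }) touch
      member : ∀ {i t} → Meets (_≡ f i) t → f i ∈ bag t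
      member (v , refl , v∈bag) = v∈bag

  module _ (L : Layering G) where
    open Layering L

    -- A clique occupies at most two consecutive layers: none lies below the
    -- lowest layer j of its members, and edges span at most one layer.
    clique-two-layers : ∀ {m} (f : Fin (suc m) → Fin n) → Clique f →
      Σ ℕ λ j → ∀ i → layer (f i) ≡ j ⊎ layer (f i) ≡ suc j
    clique-two-layers {m} f clique with argmin-Fin m (λ i → layer (f i))
    ... | i₀ , lowest = layer (f i₀) , placed
      where
      placed : ∀ i → layer (f i) ≡ layer (f i₀) ⊎ layer (f i) ≡ suc (layer (f i₀))
      placed i with i FinP.≟ i₀
      ... | yes refl = inj₁ refl
      ... | no i≢i₀ with edge-ok (f i₀) (f i) (clique i₀ i (λ e → i≢i₀ (sym e)))
      ...   | inj₁ e = inj₁ (sym e)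
      ...   | inj₂ (inj₁ e) = inj₂ (sym e)
      ...   | inj₂ (inj₂ e) = ⊥-elim (ℕP.<-irrefl refl (ℕP.≤-trans (ℕP.≤-reflexive (sym e)) (lowest i)))

    ∈-layerSet : ∀ v → v ∈ layerSet L (layer v)
    ∈-layerSet v = lookup⇒[]= v (layerSet L (layer v))
      (trans (lookup∘tabulate _ v) (trans (isYes≗does (layer v ℕ.≟ layer v)) (dec-true (layer v ℕ.≟ layer v) refl)))

  -- A clique of size m+1 meets some layer of some bag in at least half of its
  -- vertices: it lies in one bag and in two consecutive layers.
  clique-layered-width : ∀ (D : TreeDecomposition G) (L : Layering G) {m} (f : Fin (suc m) → Fin n) →
    (∀ {i j} → f i ≡ f j → i ≡ j) → Clique f →
    Σ (TreeDecomposition.Node D) λ t → Σ ℕ λ j →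
      let c = ∣ TreeDecomposition.bag D t ∩ layerSet L j ∣ in suc m ≤ c + c
  clique-layered-width D L {m} f f-injective clique =
    place (clique-bag D f clique) (clique-two-layers L f clique)
    where
    open TreeDecomposition D using (Node; bag)
    place : (Σ Node λ t → ∀ i → f i ∈ bag t) → (Σ ℕ λ j → ∀ i → Layering.layer L (f i) ≡ j ⊎ Layering.layer L (f i) ≡ suc j) →
      Σ Node λ t → Σ ℕ λ j → let c = ∣ bag t ∩ layerSet L j ∣ in suc m ≤ c + c
    place (t , in-bag) (j , two-layers) with larger-half {a = ∣ lower ∣} {b = ∣ upper ∣}
      (ℕP.≤-trans (injective-image-card {p = lower ∪ upper} f f-injective in-two-layers) (∣p∪q∣≤∣p∣+∣q∣ lower upper))
      where
      lower = bag t ∩ layerSet L j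
      upper = bag t ∩ layerSet L (suc j)
      in-layer : ∀ {l} i → Layering.layer L (f i) ≡ l → f i ∈ bag t ∩ layerSet L l
      in-layer i refl = x∈p∩q⁺ (in-bag i , ∈-layerSet L (f i))
      in-two-layers : ∀ i → f i ∈ lower ∪ upper
      in-two-layers i with two-layers i
      ... | inj₁ e = x∈p∪q⁺ (inj₁ (in-layer i e))
      ... | inj₂ e = x∈p∪q⁺ (inj₂ (in-layer i e))
    ... | inj₁ half = t , j , half
    ... | inj₂ half = t , suc j , half

module Arithmetic where
  open import Data.Nat using (_+_; _*_; _∸_; _≤_; _<_; _<?_; NonZero; >-nonZero)
  open import Data.Nat.Properties
  open import Data.Nat.DivMod using (_/_; _%_; m≡m%n+[m/n]*n; m%n<n; [m+kn]%n≡m%n; m<n⇒m%n≡m)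
  open import Data.Nat.Solver using (module +-*-Solver)
  open +-*-Solver

  -- the index of b in ℕ ∖ {a}: numbers below a keep their value, those
  -- above a move down by one
  skip : ℕ → ℕ → ℕ
  skip a b with b <? a
  ... | yes _ = b
  ... | no _ = b ∸ 1

  skip-bound : ∀ {m a b} → a ≤ m → b ≤ m → ¬ b ≡ a → skip a b < m
  skip-bound {m} {a} {b} a≤m b≤m b≢a with b <? a
  ... | yes b<a = <-≤-trans b<a a≤m
  skip-bound {b = zero} a≤m b≤m b≢a | no b≮a = ⊥-elim (b≮a (≤∧≢⇒< z≤n b≢a))
  skip-bound {b = suc b} a≤m b≤m b≢a | no b≮a = b≤m

  private
    straddle : ∀ {a c} → ¬ c < a → c ∸ 1 < a → c ≡ a
    straddle {a} {zero} c≮a _ = ≤-antisym z≤n (≮⇒≥ c≮a)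
    straddle {a} {suc c} c≮a c<a = ≤-antisym c<a (≮⇒≥ c≮a)

    pred-suc : ∀ {a c} → ¬ c ≡ a → ¬ c < a → suc (c ∸ 1) ≡ c
    pred-suc {c = zero} c≢a c≮a = ⊥-elim (c≮a (≤∧≢⇒< z≤n c≢a))
    pred-suc {c = suc c} _ _ = refl

  skip-injective : ∀ {a b b'} → ¬ b ≡ a → ¬ b' ≡ a → skip a b ≡ skip a b' → b ≡ b'
  skip-injective {a} {b} {b'} b≢a b'≢a e with b <? a | b' <? a
  ... | yes _ | yes _ = e
  ... | yes b<a | no b'≮a = ⊥-elim (b'≢a (straddle b'≮a (subst (_< a) e b<a)))
  ... | no b≮a | yes b'<a = ⊥-elim (b≢a (straddle b≮a (subst (_< a) (sym e) b'<a)))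
  ... | no b≮a | no b'≮a = trans (sym (pred-suc b≢a b≮a)) (trans (cong suc e) (pred-suc b'≢a b'≮a))

  -- The 2w numbers a' ≠ a with |a - a'| ≤ w get distinct codes below 2w:
  -- a' + w - a ranges over [0, 2w] ∖ {w}.
  window-code : ℕ → ℕ → ℕ → ℕ
  window-code w a a' = skip w ((a' + w) ∸ a)

  private
    offset≢w : ∀ {w a a'} → a ≤ a' + w → ¬ a' ≡ a → ¬ (a' + w) ∸ a ≡ w
    offset≢w {w} {a} {a'} a≤a'+w a'≢a e =
      a'≢a (sym (+-cancelʳ-≡ w a a' (trans (cong (a +_) (sym e)) (m+[n∸m]≡n a≤a'+w))))

  window-code-bound : ∀ {w a a'} → a ≤ a' + w → a' ≤ a + w → ¬ a' ≡ a → window-code w a a' < w + w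
  window-code-bound {w} {a} {a'} a≤a'+w a'≤a+w a'≢a = skip-bound (m≤m+n w w) offset≤2w (offset≢w a≤a'+w a'≢a)
    where
    offset≤2w : (a' + w) ∸ a ≤ w + w
    offset≤2w = subst ((a' + w) ∸ a ≤_) (m+n∸m≡n a (w + w))
                  (∸-monoˡ-≤ a (subst (a' + w ≤_) (+-assoc a w w) (+-monoˡ-≤ w a'≤a+w)))

  window-code-injective : ∀ {w a a₁ a₂} → a ≤ a₁ + w → a ≤ a₂ + w → ¬ a₁ ≡ a → ¬ a₂ ≡ a →
    window-code w a a₁ ≡ window-code w a a₂ → a₁ ≡ a₂
  window-code-injective {w} {a} {a₁} {a₂} a≤a₁+w a≤a₂+w a₁≢a a₂≢a e =
    +-cancelʳ-≡ w a₁ a₂ (∸-cancelʳ-≡ a≤a₁+w a≤a₂+w (skip-injective (offset≢w a≤a₁+w a₁≢a) (offset≢w a≤a₂+w a₂≢a) e))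

  multiple-in-window : ∀ {w c t m} → c < w → c + t * w ≤ m * w → m * w ≤ c + t * w + w → t ≤ m × m ≤ suc t
  multiple-in-window {w} {c} {t} {m} c<w lower upper = t≤m , m≤1+t
    where
    instance w-nonZero : NonZero w
    w-nonZero = >-nonZero (≤-<-trans z≤n c<w)
    t≤m : t ≤ m
    t≤m = *-cancelʳ-≤ t m w (≤-trans (m≤n+m (t * w) c) lower)
    m≤1+t : m ≤ suc t
    m≤1+t = ≤-pred (*-cancelʳ-< _ m (suc (suc t)) (≤-trans (s≤s upper)
              (≤-trans (+-monoˡ-≤ w (+-monoˡ-≤ (t * w) c<w))
                (≤-reflexive (solve 2 (λ w t → w :+ t :* w :+ w := (con 2 :+ t) :* w) refl w t)))))

  digits-unique : ∀ {W} .{{_ : NonZero W}} {j i j' i'} → j < W → j' < W →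
    j + i * W ≡ j' + i' * W → j ≡ j' × i ≡ i'
  digits-unique {W} {j} {i} {j'} {i'} j<W j'<W e = j≡j' , *-cancelʳ-≡ i i' W (+-cancelˡ-≡ j _ _ (trans e (cong (_+ i' * W) (sym j≡j'))))
    where
    j≡j' : j ≡ j'
    j≡j' = begin
      j                ≡⟨ sym (m<n⇒m%n≡m j<W) ⟩
      j % W            ≡⟨ sym ([m+kn]%n≡m%n j i W) ⟩
      (j + i * W) % W  ≡⟨ cong (_% W) e ⟩
      (j' + i' * W) % W ≡⟨ [m+kn]%n≡m%n j' i' W ⟩
      j' % W           ≡⟨ m<n⇒m%n≡m j'<W ⟩
      j'               ∎
      where open ≡-Reasoning

  two-digits-bound : ∀ {W j i} → j < W → i ≤ 1 → j + i * W < W + W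
  two-digits-bound {W} {j} {i} j<W i≤1 = +-mono-<-≤ j<W (≤-trans (*-monoˡ-≤ W i≤1) (≤-reflexive (*-identityˡ W)))

  choose-width : ∀ k → 6 ≤ k → Σ ℕ λ w' → 4 * suc w' + 2 ≤ k × k ≤ 4 * suc w' + 5
  choose-width k 6≤k = w' , lower , upper
    where
    w' = (k ∸ 6) / 4
    r = (k ∸ 6) % 4
    k-digits : k ≡ 6 + (r + w' * 4)
    k-digits = trans (sym (m+[n∸m]≡n 6≤k)) (cong (6 +_) (m≡m%n+[m/n]*n (k ∸ 6) 4))
    lower : 4 * suc w' + 2 ≤ k
    lower = subst₂ _≤_ (solve 1 (λ w → con 6 :+ w :* con 4 := con 4 :* (con 1 :+ w) :+ con 2) refl w') (sym k-digits)
              (+-monoʳ-≤ 6 (m≤n+m (w' * 4) r))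
    upper : k ≤ 4 * suc w' + 5
    upper = subst₂ _≤_ (sym k-digits) (solve 1 (λ w → con 6 :+ (con 3 :+ w :* con 4) := con 4 :* (con 1 :+ w) :+ con 5) refl w')
              (+-monoʳ-≤ 6 (+-monoˡ-≤ (w' * 4) (≤-pred (m%n<n (k ∸ 6) 4))))

  -- With a clique of size k+1 in one bag, half of it shares a layer.
  layered-arith : ∀ k c → suc k ≤ c + c → k ∸ 5 ≤ 256 * c
  layered-arith k c k<2c = begin
    k ∸ 5    ≤⟨ m∸n≤m k 5 ⟩
    k        ≤⟨ <⇒≤ k<2c ⟩
    c + c    ≡⟨ solve 1 (λ c → c :+ c := con 2 :* c) refl c ⟩
    2 * c    ≤⟨ *-monoˡ-≤ c {2} {256} (s≤s (s≤s z≤n)) ⟩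
    256 * c  ∎
    where open ≤-Reasoning

  -- With n = 2P²w + k + 1 vertices and a bag of size s ≥ Pw:
  -- (k - 5)·n ≤ 4w · 12wP² = 48 (Pw)² ≤ 64 s².
  treewidth-arith : ∀ k w' P' s → let w = suc w' ; P = suc P' in
    k ≤ 4 * w + 5 → P * w ≤ s → (k ∸ 5) * (2 * (P * w) * P + suc k) ≤ 64 * (s * s)
  treewidth-arith k w' P' s k≤4w+5 Pw≤s = begin
      (k ∸ 5) * n                 ≤⟨ *-monoˡ-≤ n k∸5≤4w ⟩
      (4 * w) * n                 ≤⟨ *-monoʳ-≤ (4 * w) n≤12wP² ⟩
      (4 * w) * (12 * (w * (P * P))) ≡⟨ solve 2 (λ w P → (con 4 :* w) :* (con 12 :* (w :* (P :* P))) := con 48 :* ((P :* w) :* (P :* w))) refl w P ⟩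
      48 * ((P * w) * (P * w))    ≤⟨ *-monoˡ-≤ ((P * w) * (P * w)) (m≤m+n 48 16) ⟩
      64 * ((P * w) * (P * w))    ≤⟨ *-monoʳ-≤ 64 (*-mono-≤ Pw≤s Pw≤s) ⟩
      64 * (s * s)                ∎
    where
    open ≤-Reasoning
    w = suc w'
    P = suc P'
    n = 2 * (P * w) * P + suc k
    k∸5≤4w : k ∸ 5 ≤ 4 * w
    k∸5≤4w = subst (k ∸ 5 ≤_) (m+n∸n≡m (4 * w) 5) (∸-monoˡ-≤ 5 k≤4w+5)
    k<10wP² : suc k ≤ 10 * (w * (P * P))
    k<10wP² = ≤-trans (s≤s k≤4w+5) (≤-trans (≤-reflexive (solve 1 (λ w → con 1 :+ (con 4 :* w :+ con 5) := con 4 :* w :+ con 6) refl w))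
                (≤-trans (+-monoʳ-≤ (4 * w) (*-monoʳ-≤ 6 (s≤s z≤n)))
                (≤-trans (≤-reflexive (solve 1 (λ w → con 4 :* w :+ con 6 :* w := con 10 :* w) refl w))
                (*-monoʳ-≤ 10 (m≤m*n w (P * P) {{_}})))))
    n≤12wP² : n ≤ 12 * (w * (P * P))
    n≤12wP² = ≤-trans (+-monoʳ-≤ (2 * (P * w) * P) k<10wP²)
                (≤-reflexive (solve 2 (λ w P → con 2 :* (P :* w) :* P :+ con 10 :* (w :* (P :* P)) := con 12 :* (w :* (P :* P))) refl w P))

module Construction (k w' N : ℕ) where
  open import Data.Nat using (_+_; _*_; _∸_; _≤_; _<_)
  import Data.Nat.Properties as ℕP
  import Data.Fin.Properties as FinP
  open import Data.Rational as ℚ using (ℚ; 0ℚ; 1ℚ)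
  import Data.Rational.Properties as ℚP
  open import Function.Definitions using (Injective)
  open import Function.Bundles using (_↔_; Inverse; Injection; mk↔ₛ′)
  open import Function.Properties.Inverse using (↔-refl; ↔-trans; ↔⇒↣)
  open import Data.Product.Function.NonDependent.Propositional using (_×-↔_)
  open import Data.Sum.Function.Propositional using (_⊎-↔_)
  open import Data.List using (List; length; map; allFin)
  open import Data.List.Properties using (length-map; length-tabulate)
  open import Data.List.Relation.Unary.All using (All)
  import Data.List.Relation.Unary.All.Properties as All
  open import Data.List.Relation.Unary.Unique.Propositional using (Unique)
  import Data.List.Relation.Unary.Unique.Propositional.Properties as Unique
  open import Data.Fin.Subset using (∣_∣; _∩_)
  open import Data.Fin.Subset.Properties using (_∈?_)
  open import Relation.Nullary.Decidable using (_×-dec_; _⊎-dec_)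
  open Interpolation
  open AxisSegments
  open Arithmetic
  open Counting
  open FiniteSearch

  w P : ℕ
  w = suc w'
  P = suc N

  -- A grid segment is the t-th segment of path (d, p, c): direction d
  -- (horizontal or vertical), line p, offset c ∈ [0, w).  The remaining
  -- k + 1 vertices form a star of segments.
  data Vertex : Set where
    grid : Fin 2 → Fin P → Fin w → Fin P → Vertex
    star : Fin (suc k) → Vertex

  pattern hor = Fin.zero
  pattern ver = Fin.suc Fin.zero

  n : ℕ
  n = 2 * (P * w) * P + suc k

  -- Vertices are numbered by a bijection Fin n ↔ Vertex.  It is opaque
  -- (only its inverse laws are used), so it never unfolds while type checking.
  opaque
    indexing : Fin n ↔ Vertex
    indexing = ↔-trans FinP.+↔⊎ (↔-trans
      ((↔-trans FinP.*↔× ((↔-trans FinP.*↔× (↔-refl ×-↔ FinP.*↔×)) ×-↔ ↔-refl)) ⊎-↔ ↔-refl)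
      (mk↔ₛ′ to from to-from from-to))
      where
      to : ((Fin 2 × (Fin P × Fin w)) × Fin P) ⊎ Fin (suc k) → Vertex
      to (inj₁ ((d , p , c) , t)) = grid d p c t
      to (inj₂ i) = star i
      from : Vertex → ((Fin 2 × (Fin P × Fin w)) × Fin P) ⊎ Fin (suc k)
      from (grid d p c t) = inj₁ ((d , p , c) , t)
      from (star i) = inj₂ i
      to-from : ∀ v → to (from v) ≡ v
      to-from (grid d p c t) = refl
      to-from (star i) = refl
      from-to : ∀ x → from (to x) ≡ x
      from-to (inj₁ ((d , p , c) , t)) = refl
      from-to (inj₂ i) = refl

  decode : Fin n → Vertex
  decode = Inverse.to indexing

  encode : Vertex → Fin n
  encode = Inverse.from indexing

  decode-encode : ∀ v → decode (encode v) ≡ v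
  decode-encode = Inverse.strictlyInverseˡ indexing

  decode-injective : ∀ {x y} → decode x ≡ decode y → x ≡ y
  decode-injective {x} {y} e = trans (sym (Inverse.strictlyInverseʳ indexing x))
                                     (trans (cong encode e) (Inverse.strictlyInverseʳ indexing y))

  decoded : ∀ x {v} → decode x ≡ v → encode v ≡ x
  decoded x refl = Inverse.strictlyInverseʳ indexing x

  encode-injective : ∀ {u v} → encode u ≡ encode v → u ≡ v
  encode-injective {u} {v} e = trans (sym (decode-encode u)) (trans (cong decode e) (decode-encode v))

  -- Coordinates: segment t of path (d, p, c) covers [position c t, position c t + w]
  -- along line p, which lies at height (p + 1)·w.  Consecutive segments of a
  -- path share an endpoint, and the w paths on a line are shifted by c.
  position : Fin w → Fin P → ℕ
  position c t = toℕ c + toℕ t * w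

  height : Fin P → ℕ
  height p = suc (toℕ p) * w

  horizontal : Fin P → ℕ → Segment
  horizontal p a = hseg (ι a) (ι (a + w)) (ι (height p))

  segment : Vertex → Segment
  segment (grid hor p c t) = horizontal p (position c t)
  segment (grid ver p c t) = transposeS (horizontal p (position c t))
  segment (star i) = hseg 0ℚ (ι (suc (toℕ i))) (ℚ.- 1ℚ)

  position-injective : ∀ {c t c' t'} → position c t ≡ position c' t' → c ≡ c' × t ≡ t'
  position-injective {c} {t} {c'} {t'} e with digits-unique (FinP.toℕ<n c) (FinP.toℕ<n c') e
  ... | c≡c' , t≡t' = FinP.toℕ-injective c≡c' , FinP.toℕ-injective t≡t'

  height-injective : ∀ {p p'} → height p ≡ height p' → p ≡ p'
  height-injective {p} {p'} e = FinP.toℕ-injective (ℕP.suc-injective (ℕP.*-cancelʳ-≡ (suc (toℕ p)) (suc (toℕ p')) w e))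

  -- Line t crosses the segments t of the paths on the perpendicular lines.
  height-in-window : ∀ c t → position c t ≤ height t × height t ≤ position c t + w
  height-in-window c t =
    ℕP.+-monoˡ-≤ (toℕ t * w) (ℕP.<⇒≤ (FinP.toℕ<n c)) ,
    ℕP.≤-trans (ℕP.≤-reflexive (ℕP.+-comm w (toℕ t * w)))
      (ℕP.≤-trans (ℕP.m≤n+m (toℕ t * w + w) (toℕ c)) (ℕP.≤-reflexive (sym (ℕP.+-assoc (toℕ c) (toℕ t * w) w))))

  ι-extent : ∀ a → ι a ℚ.≤ ι (a + w)
  ι-extent a = ι-mono-≤ (ℕP.m≤m+n a w)

  horizontal-horizontal : ∀ {p a p' a'} → SegIntersect (horizontal p a) (horizontal p' a') →
    p ≡ p' × a ≤ a' + w × a' ≤ a + w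
  horizontal-horizontal {p} {a} {p'} {a'} meet =
    height-injective (ι-injective (proj₁ facts)) , ι-cancel-≤ (proj₁ (proj₂ facts)) , ι-cancel-≤ (proj₂ (proj₂ facts))
    where facts = horizontal-meet (ι-extent a) (ι-extent a') meet

  horizontal-vertical : ∀ {p a q b} → SegIntersect (horizontal p a) (transposeS (horizontal q b)) →
    (a ≤ height q × height q ≤ a + w) × (b ≤ height p × height p ≤ b + w)
  horizontal-vertical {p} {a} {q} {b} meet =
    (ι-cancel-≤ (proj₁ (proj₁ facts)) , ι-cancel-≤ (proj₂ (proj₁ facts))) ,
    (ι-cancel-≤ (proj₁ (proj₂ facts)) , ι-cancel-≤ (proj₂ (proj₂ facts)))
    where facts = horizontal-vertical-meet (ι-extent a) (ι-extent b) meet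

  horizontal-vertical-meets : ∀ {p a q b} → a ≤ height q → height q ≤ a + w → b ≤ height p → height p ≤ b + w →
    SegIntersect (horizontal p a) (transposeS (horizontal q b))
  horizontal-vertical-meets {p} {a} {q} {b} a≤x x≤a+w b≤y y≤b+w =
    horizontal-vertical-cross (ι-mono-< (ℕP.m<m+n a (s≤s z≤n))) (ι-mono-< (ℕP.m<m+n b (s≤s z≤n)))
      (ι-mono-≤ a≤x) (ι-mono-≤ x≤a+w) (ι-mono-≤ b≤y) (ι-mono-≤ y≤b+w)

  start-x start-y end-x : Segment → ℚ
  start-x ((x , _) , _) = x
  start-y ((_ , y) , _) = y
  end-x (_ , (x , _)) = x

  degenerate : ∀ a → ¬ ι a ≡ ι (a + w)
  degenerate a e = ℕP.m+1+n≢m a (sym (ι-injective e))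

  -- The star segments lie on the line y = -1, below every grid segment.
  ι≰-1 : ∀ a → ¬ ι a ℚ.≤ ℚ.- 1ℚ
  ι≰-1 a ι≤-1 = ℚP.<-irrefl refl (ℚP.≤-<-trans (ι-nonNeg a) (ℚP.≤-<-trans ι≤-1 (ℚP.negative⁻¹ (ℚ.- 1ℚ))))

  star-apart : ∀ d p c t i → ¬ SegIntersect (segment (grid d p c t)) (segment (star i))
  star-apart hor p c t i meet =
    ι≰-1 (height p) (ℚP.≤-reflexive (proj₁ (horizontal-meet (ι-extent (position c t)) (ι-nonNeg (suc (toℕ i))) meet)))
  star-apart ver p c t i meet =
    ι≰-1 (position c t) (proj₁ (proj₂ (horizontal-vertical-meet (ι-nonNeg (suc (toℕ i))) (ι-extent (position c t)) (meet-sym meet))))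

  segments : Fin n → Segment
  segments x = segment (decode x)

  G : Graph n
  G = IntersectionGraph segments

  open Decompositions G

  Meet : Vertex → Vertex → Set
  Meet u v = ¬ u ≡ v × SegIntersect (segment u) (segment v)

  edge→meet : ∀ {x y} → G x y → Meet (decode x) (decode y)
  edge→meet (x≢y , meet) = (λ e → x≢y (decode-injective e)) , meet

  meet→edge : ∀ {u v} → Meet u v → G (encode u) (encode v)
  meet→edge {u} {v} (u≢v , meet) = (λ e → u≢v (encode-injective e)) ,
    subst₂ (λ u' v' → SegIntersect (segment u') (segment v')) (sym (decode-encode u)) (sym (decode-encode v)) meet

  G-symmetric : ∀ {x y} → G x y → G y x
  G-symmetric (x≢y , meet) = (λ e → x≢y (sym e)) , meet-sym meet

  flip : Vertex → Vertex
  flip (grid hor p c t) = grid ver p c t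
  flip (grid ver p c t) = grid hor p c t
  flip (star i) = star i

  flip-injective : ∀ {u v} → flip u ≡ flip v → u ≡ v
  flip-injective {u} {v} e = trans (sym (flip-flip u)) (trans (cong flip e) (flip-flip v))
    where
    flip-flip : ∀ u → flip (flip u) ≡ u
    flip-flip (grid hor p c t) = refl
    flip-flip (grid ver p c t) = refl
    flip-flip (star i) = refl

  meet-flip : ∀ p c t u → Meet (grid ver p c t) u → Meet (grid hor p c t) (flip u)
  meet-flip p c t (grid hor q c' t') (ne , meet) = (λ e → ne (flip-injective e)) , meet-transpose meet
  meet-flip p c t (grid ver q c' t') (ne , meet) = (λ e → ne (flip-injective e)) , meet-transpose meet
  meet-flip p c t (star i) (ne , meet) = ⊥-elim (star-apart ver p c t i meet)

  -- The neighbours of the horizontal segment (p, c, t) are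
  -- the horizontal segments of line p overlapping it (at most 2w, coded by
  -- window-code) and the vertical segments crossing it: these lie on
  -- line t or t - 1 and their position is determined by height p (at most
  -- 2(w+1), coded by two digits).  Vertical segments are handled by flip,
  -- and the star segments are coded by skip.
  horizontal-code : Fin P → Fin w → Fin P → Vertex → ℕ
  horizontal-code p c t (grid hor p' c' t') = window-code w (position c t) (position c' t')
  horizontal-code p c t (grid ver q c' t') =
    (w + w) + ((height p ∸ position c' t') + (suc (toℕ q) ∸ toℕ t) * suc w)
  horizontal-code p c t (star i) = 0

  neighbour-code : Vertex → Vertex → ℕ
  neighbour-code (grid hor p c t) u = horizontal-code p c t u
  neighbour-code (grid ver p c t) u = horizontal-code p c t (flip u)
  neighbour-code (star i) (grid _ _ _ _) = 0
  neighbour-code (star i) (star j) = skip (toℕ i) (toℕ j)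

  private
    crossing-digits : ∀ {p c t q c' t'} → SegIntersect (segment (grid hor p c t)) (segment (grid ver q c' t')) →
      (toℕ t ≤ suc (toℕ q) × suc (toℕ q) ∸ toℕ t ≤ 1) × (position c' t' ≤ height p × height p ∸ position c' t' < suc w)
    crossing-digits {p} {c} {t} {q} {c'} {t'} meet =
      (proj₁ window , ℕP.≤-trans (ℕP.∸-monoˡ-≤ (toℕ t) (proj₂ window)) (ℕP.≤-reflexive (ℕP.m+n∸n≡m 1 (toℕ t)))) ,
      (proj₁ (proj₂ facts) , s≤s (ℕP.≤-trans (ℕP.∸-monoˡ-≤ (position c' t') (proj₂ (proj₂ facts)))
                                            (ℕP.≤-reflexive (ℕP.m+n∸m≡n (position c' t') w))))
      where
      facts = horizontal-vertical {p} {position c t} {q} {position c' t'} meet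
      window = multiple-in-window (FinP.toℕ<n c) (proj₁ (proj₁ facts)) (proj₂ (proj₁ facts))

    grid-cong : ∀ {d p c t p' c' t'} → p ≡ p' → position c t ≡ position c' t' → grid d p c t ≡ grid d p' c' t'
    grid-cong {d} {p} {c} {t} {_} {c'} {t'} refl e = cong₂ (grid d p) (proj₁ positions) (proj₂ positions)
      where positions = position-injective {c} {t} {c'} {t'} e

    distinct-position : ∀ {p c t p' c' t'} → p ≡ p' → ¬ grid hor p c t ≡ grid hor p' c' t' → ¬ position c' t' ≡ position c t
    distinct-position p≡p' ne e = ne (grid-cong p≡p' (sym e))

  degree-bound : ℕ
  degree-bound = 4 * w + 2

  -- the codes of neighbours of a grid segment range below 2w + 2(w + 1) = 4w + 2
  code-range : degree-bound ≤ k → (w + w) + (suc w + suc w) ≤ k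
  code-range = subst (_≤ k) (count w)
    where
    open import Data.Nat.Solver using (module +-*-Solver)
    open +-*-Solver
    count : ∀ x → 4 * x + 2 ≡ (x + x) + (suc x + suc x)
    count = solve 1 (λ x → con 4 :* x :+ con 2 := (x :+ x) :+ ((con 1 :+ x) :+ (con 1 :+ x))) refl

  horizontal-neighbour-code : ∀ {p c t p' c' t'} → Meet (grid hor p c t) (grid hor p' c' t') →
    window-code w (position c t) (position c' t') < w + w
  horizontal-neighbour-code {p} {c} {t} {p'} {c'} {t'} (ne , meet) =
    window-code-bound (proj₁ (proj₂ facts)) (proj₂ (proj₂ facts)) (distinct-position (proj₁ facts) ne)
    where facts = horizontal-horizontal {p} {position c t} {p'} {position c' t'} meet

  horizontal-code-bound : ∀ p c t u → Meet (grid hor p c t) u → horizontal-code p c t u < (w + w) + (suc w + suc w)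
  horizontal-code-bound p c t (grid hor p' c' t') meet =
    ℕP.<-≤-trans (horizontal-neighbour-code meet) (ℕP.m≤m+n (w + w) _)
  horizontal-code-bound p c t (grid ver q c' t') (ne , meet) =
    ℕP.+-monoʳ-< (w + w) (two-digits-bound (proj₂ (proj₂ digits)) (proj₂ (proj₁ digits)))
    where digits = crossing-digits {p} {c} {t} {q} {c'} {t'} meet
  horizontal-code-bound p c t (star i) (ne , meet) = ⊥-elim (star-apart hor p c t i meet)

  horizontal-code-injective : ∀ p c t u₁ u₂ → Meet (grid hor p c t) u₁ → Meet (grid hor p c t) u₂ →
    horizontal-code p c t u₁ ≡ horizontal-code p c t u₂ → u₁ ≡ u₂
  horizontal-code-injective p c t (grid hor p₁ c₁ t₁) (grid hor p₂ c₂ t₂) (ne₁ , meet₁) (ne₂ , meet₂) e =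
    grid-cong (trans (sym (proj₁ facts₁)) (proj₁ facts₂))
      (window-code-injective (proj₁ (proj₂ facts₁)) (proj₁ (proj₂ facts₂))
        (distinct-position (proj₁ facts₁) ne₁) (distinct-position (proj₁ facts₂) ne₂) e)
    where
    facts₁ = horizontal-horizontal {p} {position c t} {p₁} {position c₁ t₁} meet₁
    facts₂ = horizontal-horizontal {p} {position c t} {p₂} {position c₂ t₂} meet₂
  horizontal-code-injective p c t (grid hor p₁ c₁ t₁) (grid ver q₂ c₂ t₂) meet₁ _ e =
    ⊥-elim (ℕP.<⇒≱ (horizontal-neighbour-code meet₁) (ℕP.≤-trans (ℕP.m≤m+n (w + w) _) (ℕP.≤-reflexive (sym e))))
  horizontal-code-injective p c t (grid ver q₁ c₁ t₁) (grid hor p₂ c₂ t₂) _ meet₂ e =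
    ⊥-elim (ℕP.<⇒≱ (horizontal-neighbour-code meet₂) (ℕP.≤-trans (ℕP.m≤m+n (w + w) _) (ℕP.≤-reflexive e)))
  horizontal-code-injective p c t (grid ver q₁ c₁ t₁) (grid ver q₂ c₂ t₂) (_ , meet₁) (_ , meet₂) e =
    cong₂ (λ q b → grid ver q (proj₁ b) (proj₂ b)) same-line same-position
    where
    digits₁ = crossing-digits {p} {c} {t} {q₁} {c₁} {t₁} meet₁
    digits₂ = crossing-digits {p} {c} {t} {q₂} {c₂} {t₂} meet₂
    same-digits = digits-unique (proj₂ (proj₂ digits₁)) (proj₂ (proj₂ digits₂)) (ℕP.+-cancelˡ-≡ (w + w) _ _ e)
    same-line : q₁ ≡ q₂
    same-line = FinP.toℕ-injective (ℕP.suc-injective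
                  (ℕP.∸-cancelʳ-≡ (proj₁ (proj₁ digits₁)) (proj₁ (proj₁ digits₂)) (proj₂ same-digits)))
    same-position : (c₁ , t₁) ≡ (c₂ , t₂)
    same-position = cong₂ _,_ (proj₁ positions) (proj₂ positions)
      where positions = position-injective {c₁} {t₁} {c₂} {t₂}
              (ℕP.∸-cancelˡ-≡ (proj₁ (proj₂ digits₁)) (proj₁ (proj₂ digits₂)) (proj₁ same-digits))
  horizontal-code-injective p c t (star i) _ (_ , meet₁) _ _ = ⊥-elim (star-apart hor p c t i meet₁)
  horizontal-code-injective p c t (grid _ _ _ _) (star i) _ (_ , meet₂) _ = ⊥-elim (star-apart hor p c t i meet₂)

  star-neighbour : ∀ i u → Meet (star i) u → Σ (Fin (suc k)) λ j → u ≡ star j × ¬ toℕ j ≡ toℕ i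
  star-neighbour i (grid d p c t) (_ , meet) = ⊥-elim (star-apart d p c t i (meet-sym meet))
  star-neighbour i (star j) (ne , _) = j , refl , λ e → ne (cong star (sym (FinP.toℕ-injective e)))

  neighbour-code-bound : degree-bound ≤ k → ∀ v u → Meet v u → neighbour-code v u < k
  neighbour-code-bound bound≤k (grid hor p c t) u meet =
    ℕP.<-≤-trans (horizontal-code-bound p c t u meet) (code-range bound≤k)
  neighbour-code-bound bound≤k (grid ver p c t) u meet =
    ℕP.<-≤-trans (horizontal-code-bound p c t (flip u) (meet-flip p c t u meet)) (code-range bound≤k)
  neighbour-code-bound bound≤k (star i) u meet with star-neighbour i u meet
  ... | j , refl , j≢i = skip-bound (ℕP.≤-pred (FinP.toℕ<n i)) (ℕP.≤-pred (FinP.toℕ<n j)) j≢i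

  neighbour-code-injective : ∀ v u₁ u₂ → Meet v u₁ → Meet v u₂ → neighbour-code v u₁ ≡ neighbour-code v u₂ → u₁ ≡ u₂
  neighbour-code-injective (grid hor p c t) u₁ u₂ meet₁ meet₂ e = horizontal-code-injective p c t u₁ u₂ meet₁ meet₂ e
  neighbour-code-injective (grid ver p c t) u₁ u₂ meet₁ meet₂ e =
    flip-injective (horizontal-code-injective p c t (flip u₁) (flip u₂) (meet-flip p c t u₁ meet₁) (meet-flip p c t u₂ meet₂) e)
  neighbour-code-injective (star i) u₁ u₂ meet₁ meet₂ e with star-neighbour i u₁ meet₁ | star-neighbour i u₂ meet₂
  ... | j₁ , refl , j₁≢i | j₂ , refl , j₂≢i = cong star (FinP.toℕ-injective (skip-injective j₁≢i j₂≢i e))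

  -- The star segments all start at (0, -1): they form a clique.
  star-clique : ∀ i j → ¬ i ≡ j → Meet (star i) (star j)
  star-clique i j i≢j = (λ { refl → i≢j refl }) , meet-common-start _ _ _

  star-injective : ∀ {i j} → encode (star i) ≡ encode (star j) → i ≡ j
  star-injective e with encode-injective e
  ... | refl = refl

  -- Codes bound the degree by 4w + 2 ≤ k, and star 0 has the k neighbours
  -- star 1, …, star k.
  max-degree : degree-bound ≤ k → MaxDegree G k
  max-degree bound≤k = degree≤k , encode (star Fin.zero) , neighbours , (unique , adjacent) , length-k
    where
    degree≤k : ∀ x xs → NeighbourList G x xs → length xs ≤ k
    degree≤k x xs (unique , adjacent) =
      coded-list-bound (λ y → neighbour-code (decode x) (decode y))
        (λ xy → neighbour-code-bound bound≤k (decode x) _ (edge→meet xy))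
        (λ xy₁ xy₂ e → decode-injective (neighbour-code-injective (decode x) _ _ (edge→meet xy₁) (edge→meet xy₂) e))
        xs unique adjacent
    neighbours : List (Fin n)
    neighbours = map (λ j → encode (star (Fin.suc j))) (allFin k)
    unique : Unique neighbours
    unique = Unique.map⁺ (λ e → FinP.suc-injective (star-injective e)) (Unique.allFin⁺ k)
    adjacent : All (G (encode (star Fin.zero))) neighbours
    adjacent = All.map⁺ (All.tabulate⁺ (λ j → meet→edge (star-clique Fin.zero (Fin.suc j) (λ ()))))
    length-k : length neighbours ≡ k
    length-k = trans (length-map _ (allFin k)) (length-tabulate {n = k} (λ j → j))

  segment-injective : ∀ u v → segment u ≡ segment v → u ≡ v
  segment-injective (grid hor p c t) (grid hor p' c' t') e =
    grid-cong (height-injective (ι-injective (cong start-y e))) (ι-injective (cong start-x e))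
  segment-injective (grid ver p c t) (grid ver p' c' t') e =
    grid-cong (height-injective (ι-injective (cong start-x e))) (ι-injective (cong start-y e))
  segment-injective (grid hor p c t) (grid ver q c' t') e =
    ⊥-elim (degenerate (position c t) (trans (cong start-x e) (sym (cong end-x e))))
  segment-injective (grid ver p c t) (grid hor q c' t') e =
    ⊥-elim (degenerate (position c' t') (trans (sym (cong start-x e)) (cong end-x e)))
  segment-injective (grid hor p c t) (star i) e = ⊥-elim (ι≰-1 (height p) (ℚP.≤-reflexive (cong start-y e)))
  segment-injective (grid ver p c t) (star i) e = ⊥-elim (ι≰-1 (position c t) (ℚP.≤-reflexive (cong start-y e)))
  segment-injective (star i) (grid hor p c t) e = ⊥-elim (ι≰-1 (height p) (ℚP.≤-reflexive (sym (cong start-y e))))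
  segment-injective (star i) (grid ver p c t) e = ⊥-elim (ι≰-1 (position c t) (ℚP.≤-reflexive (sym (cong start-y e))))
  segment-injective (star i) (star j) e =
    cong star (FinP.toℕ-injective (ℕP.suc-injective (ι-injective (cong end-x e))))

  segments-injective : Injective _≡_ _≡_ segments
  segments-injective {x} {y} e = decode-injective (segment-injective (decode x) (decode y) e)

  -- Paths: the segments of path (d, p, c) form a path in G, since
  -- consecutive ones share an endpoint.
  OnPath : Fin 2 → Fin P → Fin w → Vertex → Set
  OnPath d p c v = Σ (Fin P) λ t → v ≡ grid d p c t

  on-path? : ∀ d p c v → Dec (OnPath d p c v)
  on-path? d p c (grid d' p' c' t) with d' FinP.≟ d | p' FinP.≟ p | c' FinP.≟ c
  ... | yes refl | yes refl | yes refl = yes (t , refl)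
  ... | no d'≢d | _ | _ = no λ { (_ , refl) → d'≢d refl }
  ... | _ | no p'≢p | _ = no λ { (_ , refl) → p'≢p refl }
  ... | _ | _ | no c'≢c = no λ { (_ , refl) → c'≢c refl }
  on-path? d p c (star i) = no λ ()

  paths-disjoint : ∀ {d p c p' c' v} → OnPath d p c v → OnPath d p' c' v → (p , c) ≡ (p' , c')
  paths-disjoint (_ , refl) (_ , refl) = refl

  consecutive-meet : ∀ d p c {t t'} → toℕ t' ≡ suc (toℕ t) → Meet (grid d p c t') (grid d p c t)
  consecutive-meet d p c {t} {t'} t'≡1+t = distinct , meets d
    where
    distinct : ¬ grid d p c t' ≡ grid d p c t
    distinct refl = ℕP.1+n≢n (sym t'≡1+t)
    next : position c t' ≡ position c t + w
    next = begin
      toℕ c + toℕ t' * w          ≡⟨ cong (λ m → toℕ c + m * w) t'≡1+t ⟩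
      toℕ c + (w + toℕ t * w)     ≡⟨ cong (toℕ c +_) (ℕP.+-comm w (toℕ t * w)) ⟩
      toℕ c + (toℕ t * w + w)     ≡⟨ sym (ℕP.+-assoc (toℕ c) (toℕ t * w) w) ⟩
      position c t + w            ∎
      where open ≡-Reasoning
    horizontal-case : SegIntersect (horizontal p (position c t')) (horizontal p (position c t))
    horizontal-case = subst (λ b → SegIntersect (horizontal p b) (horizontal p (position c t))) (sym next)
                        (meet-sym (meet-consecutive _ _ _))
    meets : ∀ d → SegIntersect (segment (grid d p c t')) (segment (grid d p c t))
    meets hor = horizontal-case
    meets ver = meet-transpose horizontal-case

  walk-to-first : ∀ {X} d p c → (∀ t → X (encode (grid d p c t))) →
    ∀ t → Walk X (encode (grid d p c t)) (encode (grid d p c Fin.zero))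
  walk-to-first {X} d p c on-path t = subst (λ s → Walk X (encode (grid d p c s)) _) (FinP.fromℕ<-toℕ t (FinP.toℕ<n t))
                                       (down (toℕ t) (FinP.toℕ<n t))
    where
    down : ∀ m (m<P : m < P) → Walk X (encode (grid d p c (Fin.fromℕ< m<P))) (encode (grid d p c Fin.zero))
    down zero _ = stay (on-path Fin.zero)
    down (suc m) m<P = move (meet→edge (consecutive-meet d p c (trans (FinP.toℕ-fromℕ< m<P) (cong suc (sym (FinP.toℕ-fromℕ< m<P'))))))
                          (on-path _) (down m m<P')
      where m<P' = ℕP.<-trans (ℕP.n<1+n m) m<P

  -- Crosses: row path (p, c) together with column path (q, c').  Segment q
  -- of the row crosses segment p of the column, so crosses are connected,
  -- and any two crosses touch.  They form a bramble.
  crossing-meet : ∀ p c q c' → Meet (grid hor p c q) (grid ver q c' p)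
  crossing-meet p c q c' = (λ ()) ,
    horizontal-vertical-meets {p} {position c q} {q} {position c' p} (proj₁ (height-in-window c q)) (proj₂ (height-in-window c q))
                              (proj₁ (height-in-window c' p)) (proj₂ (height-in-window c' p))

  CrossIndex : Set
  CrossIndex = (Fin P × Fin w) × (Fin P × Fin w)

  InCross : CrossIndex → Fin n → Set
  InCross ((p , c) , (q , c')) x = OnPath hor p c (decode x) ⊎ OnPath ver q c' (decode x)

  in-cross? : ∀ i x → Dec (InCross i x)
  in-cross? ((p , c) , (q , c')) x = on-path? hor p c (decode x) ⊎-dec on-path? ver q c' (decode x)

  on-row : ∀ {p c q c'} t → InCross ((p , c) , (q , c')) (encode (grid hor p c t))
  on-row t = inj₁ (t , decode-encode _)

  on-column : ∀ {p c q c'} t → InCross ((p , c) , (q , c')) (encode (grid ver q c' t))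
  on-column t = inj₂ (t , decode-encode _)

  crossing : CrossIndex → Fin n
  crossing ((p , c) , (q , _)) = encode (grid hor p c q)

  walk-to-crossing : ∀ i {x} → InCross i x → Walk (InCross i) x (crossing i)
  walk-to-crossing ((p , c) , (q , c')) {x} (inj₁ (t , e)) =
    subst (λ y → Walk _ y _) (decoded x e)
      (walk-to-first hor p c on-row t ++ʷ walk-reverse G-symmetric (walk-to-first hor p c on-row q))
  walk-to-crossing ((p , c) , (q , c')) {x} (inj₂ (t , e)) =
    subst (λ y → Walk _ y _) (decoded x e)
      (walk-to-first ver q c' on-column t ++ʷ walk-reverse G-symmetric (walk-to-first ver q c' on-column p) ++ʷ
       move (G-symmetric (meet→edge (crossing-meet p c q c'))) (on-column p) (stay (on-row q)))

  crosses-touch : ∀ i j → Touch (InCross i) (InCross j)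
  crosses-touch ((p , c) , _) (_ , (q , c')) =
    encode (grid hor p c q) , encode (grid ver q c' p) , on-row q , on-column p , inj₂ (meet→edge (crossing-meet p c q c'))

  -- Every tree decomposition has a bag meeting all crosses.  Such a bag meets
  -- all P·w row paths or, missing one row, all P·w column paths; as paths
  -- are disjoint it has at least P·w vertices.
  large-bag : (D : TreeDecomposition G) → Σ (TreeDecomposition.Node D) λ t → P * w ≤ ∣ TreeDecomposition.bag D t ∣
  large-bag D = t , rows-or-columns (FinP.all? λ p → FinP.all? λ c → path-met? hor p c)
    where
    open TreeDecomposition D using (Node; bag)

    argmax : HasArgMax CrossIndex
    argmax = argmax-× (argmax-× (argmax-Fin N) (argmax-Fin w')) (argmax-× (argmax-Fin N) (argmax-Fin w'))

    crosses : Σ Node λ t → ∀ i → Meets D (InCross i) t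
    crosses = bramble-bag D argmax InCross in-cross? (λ ((p , c) , (q , c')) → crossing ((p , c) , (q , c')) , on-row q)
                (λ i → connected-via-hub G-symmetric (walk-to-crossing i)) crosses-touch

    t : Node
    t = proj₁ crosses

    PathMet : Fin 2 → Fin P → Fin w → Set
    PathMet d p c = Meets D (λ x → OnPath d p c (decode x)) t

    path-met? : ∀ d p c → Dec (PathMet d p c)
    path-met? d p c = FinP.any? λ x → on-path? d p c (decode x) ×-dec (x ∈? bag t)

    all-paths : ∀ d → (∀ p c → PathMet d p c) → P * w ≤ ∣ bag t ∣
    all-paths d met = hitting-card {p = bag t} (Inverse.to (FinP.*↔× {P} {w})) (Injection.injective (↔⇒↣ (FinP.*↔× {P} {w})))
                        (λ pc x → OnPath d (proj₁ pc) (proj₂ pc) (decode x)) paths-disjoint (λ pc → met (proj₁ pc) (proj₂ pc))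

    -- if row (p₀, c₀) is missed, every cross through it is met in its column
    columns : ∀ p₀ c₀ → ¬ PathMet hor p₀ c₀ → ∀ q c' → PathMet ver q c'
    columns p₀ c₀ ¬row q c' = in-column (proj₂ crosses ((p₀ , c₀) , (q , c')))
      where
      in-column : Meets D (InCross ((p₀ , c₀) , (q , c'))) t → PathMet ver q c'
      in-column (x , inj₁ on-row₀ , x∈bag) = ⊥-elim (¬row (x , on-row₀ , x∈bag))
      in-column (x , inj₂ on-column , x∈bag) = x , on-column , x∈bag

    rows-or-columns : Dec (∀ p c → PathMet hor p c) → P * w ≤ ∣ bag t ∣
    rows-or-columns (yes rows) = all-paths hor rows
    rows-or-columns (no ¬rows) =
      let (p₀ , ¬row) = FinP.¬∀⟶∃¬ P _ (λ p → FinP.all? λ c → path-met? hor p c) ¬rows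
          (c₀ , ¬row₀) = FinP.¬∀⟶∃¬ w _ (path-met? hor p₀) ¬row
      in all-paths ver (columns p₀ c₀ ¬row₀)

  star-edges : Clique (λ i → encode (star i))
  star-edges i j i≢j = meet→edge (star-clique i j i≢j)

  many-vertices : N ≤ n
  many-vertices = ℕP.≤-trans (ℕP.n≤1+n N) (ℕP.≤-trans (ℕP.m≤n*m P (2 * (P * w))) (ℕP.m≤m+n _ (suc k)))

  -- layered treewidth ≥ (k - 5)/256: some bag meets some layer in half the star
  layered-treewidth-bound : LayeredTreewidthBound G k
  layered-treewidth-bound D L =
    let (t , j , half) = clique-layered-width D L (λ i → encode (star i)) star-injective star-edges
    in t , j , layered-arith k ∣ TreeDecomposition.bag D t ∩ layerSet L j ∣ half

  -- treewidth ≥ √((k - 5) n)/8 - 1: some bag has at least P·w vertices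
  treewidth-bound : k ≤ 4 * w + 5 → TreewidthBound G k
  treewidth-bound k≤4w+5 D =
    let (t , large) = large-bag D
    in t , treewidth-arith k w' N ∣ TreeDecomposition.bag D t ∣ k≤4w+5 large

open Arithmetic using (choose-width)
open import Data.Nat using (_≤_)
open import Function.Definitions using (Injective)

proposition21 : (k : ℕ) → 6 ≤ k → (N : ℕ) →
    Σ ℕ λ n → N ≤ n ×
      Σ (Fin n → Segment) λ s →
        Injective _≡_ _≡_ s ×
        MaxDegree (IntersectionGraph s) k ×
        LayeredTreewidthBound (IntersectionGraph s) k ×
        TreewidthBound (IntersectionGraph s) k
proposition21 k 6≤k N =
  let (w' , 4w+2≤k , k≤4w+5) = choose-width k 6≤k
      open Construction k w' N
  in n , many-vertices , segments , segments-injective ,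
     max-degree 4w+2≤k , layered-treewidth-bound , treewidth-bound k≤4w+5
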